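{- Let $A$ be an atomic formula. If $\Gamma\vdash_{TTR}t:A$, then $t$ does not begin with $\lambda$ (i.e. $t$ is not of the form $\lambda xu$). Equivalently, if $\Gamma\vdash_{TTR}\lambda xu:B$, then $B$ is an arrow type.
   Context: Formulas. Second-order language with individual variables, function symbols (building terms), predicate symbols and predicate variables of every arity, logical symbols $\perp,\rightarrow,\forall,\mu$. Formulas: $\perp$; atomic formulas $X(t_1,\dots,t_n)$ ($X$ predicate variable or symbol); $A\rightarrow B$; $\forall xA$; $\forall XA$; $\mu Cx_1\dots x_nA\langle t_1,\dots,t_n\rangle$ with $C$ an $n$-ary predicate symbol appearing and positive in $A$ ($C,\bar x$ bound). Positivity of $X$ in $A$: not appearing: both; in $X(\bar t)$: positive only; in $B\rightarrow C$: positive (negative) iff negative (positive) in $B$ and positive (negative) in $C$; in $\forall vB$ ($v\ne X$) and $\mu C\bar xB\langle\bar t\rangle$: as in $B$. $A[G/X(x_1,\dots,x_n)]$ replaces each $X(t_1,\dots,t_n)$ by $G[t_1/x_1,\dots,t_n/x_n]$. An arrow type is a formula containing at least one $\rightarrow$. Relation $\subseteq$ (fixed set $\mathbf E$ of equations between terms; a particular case of an equation of $\mathbf E$ is $u=v$ or $v=u$ with $u,v$ obtained from both sides of an equation of $\mathbf E$ by one substitution of terms for individual variables): least relation closed under $A\subseteq A$; from $A\subseteq A'$, $B\subseteq B'$ infer $A'\rightarrow B\subseteq A\rightarrow B'$; from $A[G/v]\subseteq B$ infer $\forall vA\subseteq B$ ($G$ term or formula according to $v$); from $A\subseteq B$ infer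 $A\subseteq\forall vB$ if $v$ not free in $A$; from $A\subseteq B[u/y]$ infer $A\subseteq B[w/y]$ for $u=w$ a particular case of an equation of $\mathbf E$; transitivity; $D[\mu C\bar xD\langle\bar z\rangle/C(\bar z)][\bar t/\bar x]\subseteq\mu C\bar xD\langle\bar t\rangle$ and its converse; from $D[F/C(x_1,\dots,x_m)]\subseteq F$ infer $\mu C\bar xD\langle\bar t\rangle\subseteq F[\bar t/\bar x]$. Typing $\Gamma\vdash_{TTR}t:A$ (contexts $x_1:A_1,\dots$ with distinct variables; pure $\lambda$-terms, $(t)u$ application): $\Gamma,x:A\vdash x:A$; from $\Gamma,x:B\vdash t:C$ infer $\Gamma\vdash\lambda xt:B\rightarrow C$; from $\Gamma\vdash u:B\rightarrow C$, $\Gamma\vdash v:B$ infer $\Gamma\vdash(u)v:C$; $\forall$-introduction for individual/predicate variables not appearing in $\Gamma$; $\forall$-elimination to $A[u/x]$ ($u$ any term) and to $A[G/X(\bar x)]$ ($G$ any formula); from $\Gamma\vdash t:A[u/x]$ infer $\Gamma\vdash t:A[v/x]$ for $u=v$ a particular case of an equation of $\mathbf E$; from $\Gamma\vdash t:A$ and $A\subseteq B$ infer $\Gamma\vdash t:B$; rule (Y): from $\Gamma\vdash t:\forall\bar x[C(\bar x)\rightarrow F]\rightarrow\forall\bar x[D\rightarrow F]$ infer $\Gamma\vdash(Y)t:\forall\bar x[\mu C\bar xD\langle\bar x\rangle\rightarrow F]$, $C$ not free in $F$ nor $\Gamma$, $Y=(\lambda x\lambda y(y)(x)xy)\lambda x\lambda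 y(y)(x)xy$. -}

module Defs where

-- Syntax is intrinsically scoped de Bruijn:
--   * individual variables in scope i are  Fin i,
--   * predicate variables are positions in a context  Δ : List ℕ  of arities,
--   * λ-terms use de Bruijn indices, typing contexts are lists of formulas.

open import Data.Nat using (ℕ; zero; suc; _+_)
open import Data.Fin using (Fin; zero; suc; _↑ˡ_; _↑ʳ_; splitAt)
open import Data.Vec using (Vec; []; _∷_; lookup; tabulate)
open import Data.List using (List; []; _∷_; map)
open import Data.List.Membership.Propositional using (_∈_)
open import Data.List.Relation.Unary.Any using (here; there; index)
open import Data.Product using (Σ; _×_; _,_)
open import Data.Sum using (_⊎_; inj₁; inj₂; [_,_]′)
open import Data.Unit using (⊤)
open import Relation.Binary.PropositionalEquality using (_≡_; refl)
open import Relation.Nullary using (¬_)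

data Term (i : ℕ) : Set where
  var : Fin i → Term i
  fn  : (f n : ℕ) → Vec (Term i) n → Term i

mutual
  subT : ∀ {i j} → (Fin i → Term j) → Term i → Term j
  subT σ (var x)     = σ x
  subT σ (fn f n ts) = fn f n (subTs σ ts)

  subTs : ∀ {i j n} → (Fin i → Term j) → Vec (Term i) n → Vec (Term j) n
  subTs σ []       = []
  subTs σ (t ∷ ts) = subT σ t ∷ subTs σ ts

-- lifting a term substitution under k binders (bound variables come first)
liftT : ∀ k {i j} → (Fin i → Term j) → Fin (k + i) → Term (k + j)
liftT k {i} {j} σ x =
  [ (λ a → var (a ↑ˡ j)) , (λ b → subT (λ y → var (k ↑ʳ y)) (σ b)) ]′ (splitAt k x)

wk : ∀ n m {i} → Fin (n + i) → Fin (n + (m + i))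
wk n m {i} x = [ (λ a → a ↑ˡ (m + i)) , (λ b → n ↑ʳ (m ↑ʳ b)) ]′ (splitAt n x)

inst : ∀ n {i} → Vec (Term i) n → Fin (n + i) → Term i
inst n ts x = [ lookup ts , var ]′ (splitAt n x)

xs : ∀ n {i} → Vec (Term (n + i)) n
xs n {i} = tabulate (λ a → var (a ↑ˡ i))

-- Formulas:  ⊥ ; X(t₁,…,tₙ) (X predicate variable or predicate symbol) ;
-- A → B ; ∀x A ; ∀X A ; μ C x₁…xₙ A ⟨t₁,…,tₙ⟩
-- (in  μ n D ts , C is the predicate variable `here`, of arity n, and
--  x₁…xₙ are the first n individual variables of D)

infixr 5 _⇒_

data Formula : List ℕ → ℕ → Set where
  ⊥'  : ∀ {Δ i} → Formula Δ i
  pv  : ∀ {Δ i n} → n ∈ Δ → Vec (Term i) n → Formula Δ i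
  ps  : ∀ {Δ i} (s n : ℕ) → Vec (Term i) n → Formula Δ i
  _⇒_ : ∀ {Δ i} → Formula Δ i → Formula Δ i → Formula Δ i
  ∀ᵢ  : ∀ {Δ i} → Formula Δ (suc i) → Formula Δ i
  ∀ₚ  : ∀ {Δ i} (n : ℕ) → Formula (n ∷ Δ) i → Formula Δ i
  μ   : ∀ {Δ i} (n : ℕ) → Formula (n ∷ Δ) (n + i) → Vec (Term i) n → Formula Δ i

subI : ∀ {Δ i j} → (Fin i → Term j) → Formula Δ i → Formula Δ j
subI σ ⊥'          = ⊥'
subI σ (pv x ts)   = pv x (subTs σ ts)
subI σ (ps s n ts) = ps s n (subTs σ ts)
subI σ (A ⇒ B)     = subI σ A ⇒ subI σ B
subI σ (∀ᵢ A)      = ∀ᵢ (subI (liftT 1 σ) A)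
subI σ (∀ₚ n A)    = ∀ₚ n (subI σ A)
subI σ (μ n D ts)  = μ n (subI (liftT n σ) D) (subTs σ ts)

renI : ∀ {Δ i j} → (Fin i → Fin j) → Formula Δ i → Formula Δ j
renI r = subI (λ x → var (r x))

renP : ∀ {Δ Δ' i} → (∀ {n} → n ∈ Δ → n ∈ Δ') → Formula Δ i → Formula Δ' i
renP r ⊥'          = ⊥'
renP r (pv x ts)   = pv (r x) ts
renP r (ps s n ts) = ps s n ts
renP r (A ⇒ B)     = renP r A ⇒ renP r B
renP r (∀ᵢ A)      = ∀ᵢ (renP r A)
renP r (∀ₚ n A)    = ∀ₚ n (renP (λ { (here p) → here p ; (there x) → there (r x) }) A)
renP r (μ n D ts)  = μ n (renP (λ { (here p) → here p ; (there x) → there (r x) }) D) ts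

-- substitution of predicate variables: a variable X of arity n is sent to a
-- formula G whose first n individual variables play the role of x₁…xₙ,
-- and  X(t₁…tₙ)  is replaced by  G[t₁/x₁,…,tₙ/xₙ]
PSub : List ℕ → List ℕ → ℕ → Set
PSub Δ Δ' i = ∀ {n} → n ∈ Δ → Formula Δ' (n + i)

liftP : ∀ {Δ Δ' i} m → PSub Δ Δ' i → PSub (m ∷ Δ) (m ∷ Δ') i
liftP m σ (here refl) = pv (here refl) (xs m)
liftP m σ (there x)   = renP there (σ x)

subP : ∀ {Δ Δ' i} → PSub Δ Δ' i → Formula Δ i → Formula Δ' i
subP σ ⊥'              = ⊥'
subP σ (pv {n = n} x ts) = subI (inst n ts) (σ x)
subP σ (ps s n ts)     = ps s n ts
subP σ (A ⇒ B)         = subP σ A ⇒ subP σ B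
subP σ (∀ᵢ A)          = ∀ᵢ (subP (λ {n} x → renI (wk n 1) (σ x)) A)
subP σ (∀ₚ m A)        = ∀ₚ m (subP (liftP m σ) A)
subP σ (μ m D ts)      = μ m (subP (liftP m (λ {n} x → renI (wk n m) (σ x))) D) ts

_[_]ᵢ : ∀ {Δ i} → Formula Δ (suc i) → Term i → Formula Δ i
A [ u ]ᵢ = subI (λ { zero → u ; (suc k) → var k }) A

_[_]ₚ : ∀ {Δ i n} → Formula (n ∷ Δ) i → Formula Δ (n + i) → Formula Δ i
_[_]ₚ {Δ} {i} {n} A G = subP σ A
  where
  σ : PSub (n ∷ Δ) Δ i
  σ (here refl) = G
  σ (there x)   = pv x (xs _)

-- weakenings ("v not free in A")
wkᵢ : ∀ {Δ i} → Formula Δ i → Formula Δ (suc i)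
wkᵢ = renI suc

wkₚ : ∀ {Δ i n} → Formula Δ i → Formula (n ∷ Δ) i
wkₚ = renP there

∀ⁿ : ∀ {Δ i} n → Formula Δ (n + i) → Formula Δ i
∀ⁿ zero    A = A
∀ⁿ (suc n) A = ∀ⁿ n (∀ᵢ A)

-- D[μ C x̄ D⟨z̄⟩ / C(z̄)][t̄/x̄]
unfold : ∀ {Δ i} n → Formula (n ∷ Δ) (n + i) → Vec (Term i) n → Formula Δ i
unfold n D ts =
  subI (inst n ts) (D [ μ n (renI (wk n n) (renI (wk n n) D)) (xs n) ]ₚ)

mutual
  Pos : ∀ {Δ i n} → n ∈ Δ → Formula Δ i → Set
  Pos X ⊥'          = ⊤
  Pos X (pv Y ts)   = ⊤
  Pos X (ps s n ts) = ⊤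
  Pos X (A ⇒ B)     = Neg X A × Pos X B
  Pos X (∀ᵢ A)      = Pos X A
  Pos X (∀ₚ m A)    = Pos (there X) A
  Pos X (μ m D ts)  = Pos (there X) D

  Neg : ∀ {Δ i n} → n ∈ Δ → Formula Δ i → Set
  Neg X ⊥'          = ⊤
  Neg X (pv Y ts)   = ¬ (index Y ≡ index X)
  Neg X (ps s n ts) = ⊤
  Neg X (A ⇒ B)     = Pos X A × Neg X B
  Neg X (∀ᵢ A)      = Neg X A
  Neg X (∀ₚ m A)    = Neg (there X) A
  Neg X (μ m D ts)  = Neg (there X) D

data Appears {Δ n} (X : n ∈ Δ) : ∀ {i} → Formula Δ i → Set where
  ap-pv : ∀ {i m} {Y : m ∈ Δ} {ts : Vec (Term i) m} → index Y ≡ index X → Appears X (pv Y ts)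
  ap-⇒ˡ : ∀ {i} {A B : Formula Δ i} → Appears X A → Appears X (A ⇒ B)
  ap-⇒ʳ : ∀ {i} {A B : Formula Δ i} → Appears X B → Appears X (A ⇒ B)
  ap-∀ᵢ : ∀ {i} {A : Formula Δ (suc i)} → Appears X A → Appears X (∀ᵢ A)
  ap-∀ₚ : ∀ {i m} {A : Formula (m ∷ Δ) i} → Appears (there X) A → Appears X (∀ₚ m A)
  ap-μ  : ∀ {i m} {D : Formula (m ∷ Δ) (m + i)} {ts} → Appears (there X) D → Appears X (μ m D ts)

WF : ∀ {Δ i} → Formula Δ i → Set
WF ⊥'          = ⊤
WF (pv X ts)   = ⊤
WF (ps s n ts) = ⊤
WF (A ⇒ B)     = WF A × WF B
WF (∀ᵢ A)      = WF A
WF (∀ₚ n A)    = WF A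
WF (μ n D ts)  = Appears (here refl) D × Pos (here refl) D × WF D

data Atomic {Δ i} : Formula Δ i → Set where
  atom-pv : ∀ {n} (X : n ∈ Δ) ts → Atomic (pv X ts)
  atom-ps : ∀ s n ts → Atomic (ps s n ts)

data ArrowType : ∀ {Δ i} → Formula Δ i → Set where
  arr-⇒ : ∀ {Δ i} {A B : Formula Δ i} → ArrowType (A ⇒ B)
  arr-∀ᵢ : ∀ {Δ i} {A : Formula Δ (suc i)} → ArrowType A → ArrowType (∀ᵢ A)
  arr-∀ₚ : ∀ {Δ i n} {A : Formula (n ∷ Δ) i} → ArrowType A → ArrowType (∀ₚ n A)
  arr-μ  : ∀ {Δ i n} {D : Formula (n ∷ Δ) (n + i)} {ts} → ArrowType D → ArrowType (μ n D ts)

-- Equations: E k l r  means  l = r  is an equation of E in k variables.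

Eqns : Set₁
Eqns = (k : ℕ) → Term k → Term k → Set

PC : Eqns → ∀ {i} → Term i → Term i → Set
PC E {i} u v =
  Σ ℕ λ k → Σ (Fin k → Term i) λ σ → Σ (Term k) λ l → Σ (Term k) λ r →
    E k l r × ((u ≡ subT σ l × v ≡ subT σ r) ⊎ (u ≡ subT σ r × v ≡ subT σ l))

data Sub (E : Eqns) : ∀ {Δ i} → Formula Δ i → Formula Δ i → Set where
  ⊆-refl  : ∀ {Δ i} {A : Formula Δ i} → Sub E A A
  ⊆-arr   : ∀ {Δ i} {A A' B B' : Formula Δ i} →
            Sub E A A' → Sub E B B' → Sub E (A' ⇒ B) (A ⇒ B')
  ⊆-∀ᵢL   : ∀ {Δ i} {A : Formula Δ (suc i)} {B} (u : Term i) →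
            Sub E (A [ u ]ᵢ) B → Sub E (∀ᵢ A) B
  ⊆-∀ₚL   : ∀ {Δ i n} {A : Formula (n ∷ Δ) i} {B} (G : Formula Δ (n + i)) → WF G →
            Sub E (A [ G ]ₚ) B → Sub E (∀ₚ n A) B
  ⊆-∀ᵢR   : ∀ {Δ i} {A : Formula Δ i} {B} → Sub E (wkᵢ A) B → Sub E A (∀ᵢ B)
  ⊆-∀ₚR   : ∀ {Δ i n} {A : Formula Δ i} {B : Formula (n ∷ Δ) i} →
            Sub E (wkₚ A) B → Sub E A (∀ₚ n B)
  ⊆-eq    : ∀ {Δ i} {A : Formula Δ i} {B : Formula Δ (suc i)} {u w : Term i} →
            PC E u w → Sub E A (B [ u ]ᵢ) → Sub E A (B [ w ]ᵢ)
  ⊆-trans : ∀ {Δ i} {A B C : Formula Δ i} → WF B → Sub E A B → Sub E B C → Sub E A C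
  ⊆-fold  : ∀ {Δ i n} {D : Formula (n ∷ Δ) (n + i)} {ts} → Sub E (unfold n D ts) (μ n D ts)
  ⊆-unfold : ∀ {Δ i n} {D : Formula (n ∷ Δ) (n + i)} {ts} → Sub E (μ n D ts) (unfold n D ts)
  ⊆-ind   : ∀ {Δ i n} {D : Formula (n ∷ Δ) (n + i)} {F : Formula Δ (n + i)} {ts} →
            Sub E (D [ renI (wk n n) F ]ₚ) F → Sub E (μ n D ts) (subI (inst n ts) F)

data Λ : Set where
  ν   : ℕ → Λ
  ƛ   : Λ → Λ
  _·_ : Λ → Λ → Λ

Y : Λ
Y = θ · θ
  where θ = ƛ (ƛ (ν 0 · ((ν 1 · ν 1) · ν 0)))

Ctx : List ℕ → ℕ → Set
Ctx Δ i = List (Formula Δ i)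

data _∋_∶_ {Δ i} : Ctx Δ i → ℕ → Formula Δ i → Set where
  z∶ : ∀ {Γ A} → (A ∷ Γ) ∋ 0 ∶ A
  s∶ : ∀ {Γ A B k} → Γ ∋ k ∶ A → (B ∷ Γ) ∋ suc k ∶ A

data Ty (E : Eqns) : ∀ {Δ i} → Ctx Δ i → Λ → Formula Δ i → Set where
  ty-var : ∀ {Δ i} {Γ : Ctx Δ i} {k A} → Γ ∋ k ∶ A → Ty E Γ (ν k) A
  ty-lam : ∀ {Δ i} {Γ : Ctx Δ i} {t B C} → Ty E (B ∷ Γ) t C → Ty E Γ (ƛ t) (B ⇒ C)
  ty-app : ∀ {Δ i} {Γ : Ctx Δ i} {u v B C} → WF B →
           Ty E Γ u (B ⇒ C) → Ty E Γ v B → Ty E Γ (u · v) C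
  ty-∀ᵢI : ∀ {Δ i} {Γ : Ctx Δ i} {t A} → Ty E (map wkᵢ Γ) t A → Ty E Γ t (∀ᵢ A)
  ty-∀ₚI : ∀ {Δ i n} {Γ : Ctx Δ i} {t} {A : Formula (n ∷ Δ) i} →
           Ty E (map wkₚ Γ) t A → Ty E Γ t (∀ₚ n A)
  ty-∀ᵢE : ∀ {Δ i} {Γ : Ctx Δ i} {t A} (u : Term i) → Ty E Γ t (∀ᵢ A) → Ty E Γ t (A [ u ]ᵢ)
  ty-∀ₚE : ∀ {Δ i n} {Γ : Ctx Δ i} {t} {A : Formula (n ∷ Δ) i} (G : Formula Δ (n + i)) → WF G →
           Ty E Γ t (∀ₚ n A) → Ty E Γ t (A [ G ]ₚ)
  ty-eq  : ∀ {Δ i} {Γ : Ctx Δ i} {t} {A : Formula Δ (suc i)} {u v} →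
           PC E u v → Ty E Γ t (A [ u ]ᵢ) → Ty E Γ t (A [ v ]ᵢ)
  ty-sub : ∀ {Δ i} {Γ : Ctx Δ i} {t A B} → WF A → Ty E Γ t A → Sub E A B → Ty E Γ t B
  ty-Y   : ∀ {Δ i n} {Γ : Ctx Δ i} {t} {D : Formula (n ∷ Δ) (n + i)} {F : Formula Δ (n + i)} →
           Ty E (map wkₚ Γ) t
              ((∀ⁿ n (pv (here refl) (xs n) ⇒ wkₚ F)) ⇒ ∀ⁿ n (D ⇒ wkₚ F)) →
           Ty E Γ (Y · t) (∀ⁿ n (μ n (renI (wk n n) D) (xs n) ⇒ F))

module Submission where

-- Here an "arrow type" is a formula whose head, under the prefix of
-- quantifiers ∀x, ∀X and fixpoint binders μ, is an implication.  The proof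
-- shows that this property is invariant under everything the typing rules
-- can do to the type of a fixed term:
--   * it is preserved by term substitution, predicate renaming and predicate
--     substitution, and reflected by term substitution and predicate renaming;
--   * it is reflected by predicate substitution up to the substituted
--     formulas: if A[σ] is an arrow type, then A is one, or some σ(X) is;
--   * hence the unfolding D[μ C x̄ D / C] of a fixpoint is an arrow type only
--     when D is (the formula substituted for C is a μ over D again);
--   * hence A ⊆ B maps arrow types to arrow types, rule by rule.
-- By induction on typing derivations, every type of λx u is an arrow type;
-- since atomic formulas are not arrow types, no term of atomic type is an
-- abstraction.

open import Defs
open import Data.Nat using (ℕ; _+_)
open import Data.Fin using (Fin)
open import Data.List using (List; _∷_)
open import Data.List.Membership.Propositional using (_∈_)
open import Data.List.Relation.Unary.Any using (here; there)
open import Data.List.Relation.Unary.All using (All)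
open import Data.Product using (_×_; _,_; Σ)
open import Data.Sum using (_⊎_; inj₁; inj₂)
open import Relation.Nullary using (¬_)
open import Relation.Binary.PropositionalEquality using (_≢_; _≡_; refl)

subI-arrow : ∀ {Δ i j} (σ : Fin i → Term j) {A : Formula Δ i} →
             ArrowType A → ArrowType (subI σ A)
subI-arrow σ arr-⇒      = arr-⇒
subI-arrow σ (arr-∀ᵢ a) = arr-∀ᵢ (subI-arrow _ a)
subI-arrow σ (arr-∀ₚ a) = arr-∀ₚ (subI-arrow σ a)
subI-arrow σ (arr-μ a)  = arr-μ (subI-arrow _ a)

subI-arrow⁻ : ∀ {Δ i j} (σ : Fin i → Term j) (A : Formula Δ i) →
              ArrowType (subI σ A) → ArrowType A
subI-arrow⁻ σ ⊥'          ()
subI-arrow⁻ σ (pv X ts)   ()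
subI-arrow⁻ σ (ps s n ts) ()
subI-arrow⁻ σ (A ⇒ B)     _          = arr-⇒
subI-arrow⁻ σ (∀ᵢ A)      (arr-∀ᵢ a) = arr-∀ᵢ (subI-arrow⁻ _ A a)
subI-arrow⁻ σ (∀ₚ n A)    (arr-∀ₚ a) = arr-∀ₚ (subI-arrow⁻ σ A a)
subI-arrow⁻ σ (μ n D ts)  (arr-μ a)  = arr-μ (subI-arrow⁻ _ D a)

renP-arrow : ∀ {Δ Δ' i} (r : ∀ {n} → n ∈ Δ → n ∈ Δ') {A : Formula Δ i} →
             ArrowType A → ArrowType (renP r A)
renP-arrow r arr-⇒      = arr-⇒
renP-arrow r (arr-∀ᵢ a) = arr-∀ᵢ (renP-arrow r a)
renP-arrow r (arr-∀ₚ a) = arr-∀ₚ (renP-arrow _ a)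
renP-arrow r (arr-μ a)  = arr-μ (renP-arrow _ a)

renP-arrow⁻ : ∀ {Δ Δ' i} (r : ∀ {n} → n ∈ Δ → n ∈ Δ') (A : Formula Δ i) →
              ArrowType (renP r A) → ArrowType A
renP-arrow⁻ r ⊥'          ()
renP-arrow⁻ r (pv X ts)   ()
renP-arrow⁻ r (ps s n ts) ()
renP-arrow⁻ r (A ⇒ B)     _          = arr-⇒
renP-arrow⁻ r (∀ᵢ A)      (arr-∀ᵢ a) = arr-∀ᵢ (renP-arrow⁻ r A a)
renP-arrow⁻ r (∀ₚ n A)    (arr-∀ₚ a) = arr-∀ₚ (renP-arrow⁻ _ A a)
renP-arrow⁻ r (μ n D ts)  (arr-μ a)  = arr-μ (renP-arrow⁻ _ D a)

subP-arrow : ∀ {Δ Δ' i} (σ : PSub Δ Δ' i) {A : Formula Δ i} →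
             ArrowType A → ArrowType (subP σ A)
subP-arrow σ arr-⇒      = arr-⇒
subP-arrow σ (arr-∀ᵢ a) = arr-∀ᵢ (subP-arrow _ a)
subP-arrow σ (arr-∀ₚ a) = arr-∀ₚ (subP-arrow _ a)
subP-arrow σ (arr-μ a)  = arr-μ (subP-arrow _ a)

SendsToArrow : ∀ {Δ Δ' i} → PSub Δ Δ' i → Set
SendsToArrow {Δ} σ = Σ ℕ λ n → Σ (n ∈ Δ) λ X → ArrowType (σ X)

-- Lifting σ under a binder adds only the bound variable, which is sent to an
-- atom; so a lifted substitution sends a variable to an arrow type only if σ does.
liftP-sendsToArrow : ∀ {Δ Δ' i} m (σ : PSub Δ Δ' i) →
                     SendsToArrow (liftP m σ) → SendsToArrow σ
liftP-sendsToArrow m σ (n , here refl , ())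
liftP-sendsToArrow m σ (n , there X , a) = n , X , renP-arrow⁻ there (σ X) a

-- If A[σ] is an arrow type, its arrow comes either from A itself or from the
-- formula σ(X) substituted for a head variable X of A.
subP-arrow⁻ : ∀ {Δ Δ' i} (σ : PSub Δ Δ' i) (A : Formula Δ i) →
              ArrowType (subP σ A) → ArrowType A ⊎ SendsToArrow σ
subP-arrow⁻ σ ⊥'                ()
subP-arrow⁻ σ (pv {n = n} X ts) a = inj₂ (n , X , subI-arrow⁻ _ (σ X) a)
subP-arrow⁻ σ (ps s n ts)       ()
subP-arrow⁻ σ (A ⇒ B)           _ = inj₁ arr-⇒
subP-arrow⁻ σ (∀ᵢ A) (arr-∀ᵢ a) with subP-arrow⁻ _ A a
... | inj₁ b           = inj₁ (arr-∀ᵢ b)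
... | inj₂ (n , X , b) = inj₂ (n , X , subI-arrow⁻ _ (σ X) b)
subP-arrow⁻ σ (∀ₚ m A) (arr-∀ₚ a) with subP-arrow⁻ _ A a
... | inj₁ b = inj₁ (arr-∀ₚ b)
... | inj₂ s = inj₂ (liftP-sendsToArrow m σ s)
subP-arrow⁻ σ (μ m D ts) (arr-μ a) with subP-arrow⁻ _ D a
... | inj₁ b = inj₁ (arr-μ b)
... | inj₂ s with liftP-sendsToArrow m _ s
...   | (n , X , b) = inj₂ (n , X , subI-arrow⁻ _ (σ X) b)

-- The unfolding D[μ C x̄ D / C][t̄/x̄] is an arrow type only if D is: the only
-- formula substituted for a variable with arrow-type image is μ C x̄ D itself.
unfold-arrow⁻ : ∀ {Δ i} n (D : Formula (n ∷ Δ) (n + i)) ts →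
                ArrowType (unfold n D ts) → ArrowType D
unfold-arrow⁻ n D ts a with subP-arrow⁻ _ D (subI-arrow⁻ _ _ a)
... | inj₁ b                           = b
... | inj₂ (m , here refl , arr-μ b)   = subI-arrow⁻ _ D (subI-arrow⁻ _ _ b)
... | inj₂ (m , there X , ())

⊆-arrow : ∀ {E Δ i} {A B : Formula Δ i} → Sub E A B → ArrowType A → ArrowType B
⊆-arrow ⊆-refl              a          = a
⊆-arrow (⊆-arr _ _)         _          = arr-⇒
⊆-arrow (⊆-∀ᵢL u s)         (arr-∀ᵢ a) = ⊆-arrow s (subI-arrow _ a)
⊆-arrow (⊆-∀ₚL G _ s)       (arr-∀ₚ a) = ⊆-arrow s (subP-arrow _ a)
⊆-arrow (⊆-∀ᵢR s)           a          = arr-∀ᵢ (⊆-arrow s (subI-arrow _ a))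
⊆-arrow (⊆-∀ₚR s)           a          = arr-∀ₚ (⊆-arrow s (renP-arrow _ a))
⊆-arrow (⊆-eq {B = B} _ s)  a          = subI-arrow _ (subI-arrow⁻ _ B (⊆-arrow s a))
⊆-arrow (⊆-trans _ s s')    a          = ⊆-arrow s' (⊆-arrow s a)
⊆-arrow (⊆-fold {n = n} {D} {ts}) a    = arr-μ (unfold-arrow⁻ n D ts a)
⊆-arrow ⊆-unfold            (arr-μ a)  = subI-arrow _ (subP-arrow _ a)
⊆-arrow (⊆-ind s)           (arr-μ a)  = subI-arrow _ (⊆-arrow s (subP-arrow _ a))

-- Every type of an abstraction is an arrow type.  The subject is kept general
-- (with t ≡ ƛ u) so that induction runs over all derivations.
abstraction-arrow : ∀ {E Δ i} {Γ : Ctx Δ i} {t B u} →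
                    Ty E Γ t B → t ≡ ƛ u → ArrowType B
abstraction-arrow (ty-var _)        ()
abstraction-arrow (ty-lam _)        refl = arr-⇒
abstraction-arrow (ty-app _ _ _)    ()
abstraction-arrow (ty-∀ᵢI d)        e    = arr-∀ᵢ (abstraction-arrow d e)
abstraction-arrow (ty-∀ₚI d)        e    = arr-∀ₚ (abstraction-arrow d e)
abstraction-arrow (ty-∀ᵢE u d)      e with abstraction-arrow d e
... | arr-∀ᵢ a = subI-arrow _ a
abstraction-arrow (ty-∀ₚE G _ d)    e with abstraction-arrow d e
... | arr-∀ₚ a = subP-arrow _ a
abstraction-arrow (ty-eq {A = A} _ d) e  = subI-arrow _ (subI-arrow⁻ _ A (abstraction-arrow d e))
abstraction-arrow (ty-sub _ d s)    e    = ⊆-arrow s (abstraction-arrow d e)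
abstraction-arrow (ty-Y _)          ()

atomic-not-arrow : ∀ {Δ i} {A : Formula Δ i} → Atomic A → ¬ ArrowType A
atomic-not-arrow (atom-pv X ts)   ()
atomic-not-arrow (atom-ps s n ts) ()

corollary4p2 : (E : Eqns) {Δ : List ℕ} {i : ℕ} (Γ : Ctx Δ i) → All WF Γ →
    ((t : Λ) (A : Formula Δ i) → Atomic A → Ty E Γ t A → (u : Λ) → t ≢ ƛ u)
    × ((u : Λ) (B : Formula Δ i) → WF B → Ty E Γ (ƛ u) B → ArrowType B)
corollary4p2 E Γ _ = atomic-not-abstraction , λ u B _ d → abstraction-arrow d refl
  where
  atomic-not-abstraction : (t : Λ) (A : Formula _ _) → Atomic A → Ty E Γ t A →
                           (u : Λ) → t ≢ ƛ u
  atomic-not-abstraction t A atomic d u t≡ƛu =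
    atomic-not-arrow atomic (abstraction-arrow d t≡ƛu)
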